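{- Let $\kappa$ be a cardinal with $\kappa>2^{\aleph_0}$ and let $G$ be a torsion-free abelian group of cardinality $\kappa$. Then for every generic subset $P$ of $G$ (for example $P=\bigcup_{i<n}(A_i-A_i)$ for some partition $G=\bigcup_{i<n}A_i$) there is a nonzero $x\in G$ such that $x\mathbb{Z}\subseteq P-P$.
   Context: A subset $P$ of $G$ is generic if finitely many translates of $P$ cover $G$, i.e. $G=P+S$ for some finite $S\subseteq G$. $P-P=\{a-b: a,b\in P\}$. -}

module Defs where

open import Level using (Level; _⊔_; 0ℓ)
open import Data.Nat using (ℕ; zero; suc)
open import Data.Integer using (ℤ; +_; -[1+_])
open import Data.Bool using (Bool)
open import Data.Fin using (Fin)
open import Data.Product using (Σ; ∃; ∃-syntax; _,_) renaming (_×_ to _∧_)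
open import Relation.Nullary using (¬_)
open import Relation.Binary using (Setoid)
open import Relation.Binary.PropositionalEquality using (_≡_; refl; sym; trans)
open import Algebra.Bundles using (AbelianGroup)
import Algebra.Definitions.RawMonoid as RM

-- Cantor space 2^ℕ with pointwise (extensional) equality; its cardinality is 2^ℵ₀.
CantorSetoid : Setoid 0ℓ 0ℓ
CantorSetoid = record
  { Carrier = ℕ → Bool
  ; _≈_ = λ f g → ∀ n → f n ≡ g n
  ; isEquivalence = record
    { refl = λ n → refl
    ; sym = λ p n → sym (p n)
    ; trans = λ p q n → trans (p n) (q n) } }

module _ {c ℓ : Level} (G : AbelianGroup c ℓ) where
  open AbelianGroup G
  open RM rawMonoid using () renaming (_×_ to _·ℕ_)

  _·ℤ_ : ℤ → Carrier → Carrier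
  (+ n) ·ℤ x = n ·ℕ x
  -[1+ n ] ·ℤ x = (suc n ·ℕ x) ⁻¹

  TorsionFree : Set (c ⊔ ℓ)
  TorsionFree = ∀ (n : ℕ) (x : Carrier) → (suc n ·ℕ x) ≈ ε → x ≈ ε

  Generic : ∀ {p} → (Carrier → Set p) → Set (c ⊔ ℓ ⊔ p)
  Generic P = ∃[ m ] Σ (Fin m → Carrier) λ s →
    ∀ (g : Carrier) → ∃[ i ] ∃[ a ] (P a ∧ g ≈ (a ∙ s i))

  DiffSet : ∀ {p} → (Carrier → Set p) → Carrier → Set (c ⊔ ℓ ⊔ p)
  DiffSet P y = ∃[ a ] ∃[ b ] (P a ∧ P b ∧ y ≈ (a ∙ (b ⁻¹)))

-- Colour every g ∈ G by the countably many bits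
--     ⟨n, j⟩ ↦ "n·g lies in the translate P + s_j",
-- read off by excluded middle and indexed by ℕ through a diagonal
-- enumeration of ℕ × ℕ.  If g and h
-- receive the same colour then, for every n, the translate containing n·g
-- also contains n·h, so n·(g − h) ∈ P − P; as P − P is symmetric, also
-- k·(g − h) ∈ P − P for all k ∈ ℤ.  Hence, were there no such x, equal
-- colours would force g = h and the colouring would inject G into 2^ℕ.
module Submission where

open import Defs
open import Level using (Level; _⊔_; Lift; lift; lower)
open import Data.Nat using (ℕ; zero; suc; _+_)
open import Data.Nat.Properties using (+-suc; +-identityʳ)
open import Data.Integer using (ℤ; +_; -[1+_])
open import Data.Bool using (Bool; true)
open import Data.Fin using (Fin; toℕ)
open import Data.Fin.Properties using (toℕ-injective)
open import Data.Product using (∃-syntax; _,_) renaming (_×_ to _∧_)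
open import Function using (_∘_)
open import Function.Bundles using (Injection; _⇔_; mk⇔)
open import Relation.Nullary using (¬_; Dec; yes; does)
open import Relation.Nullary.Decidable using (dec-true; does-⇔)
open import Relation.Nullary.Negation using (Stable)
open import Relation.Unary using (Pred)
open import Relation.Binary.Definitions using (_Respects_)
open import Relation.Binary.PropositionalEquality
  using (_≡_; refl; cong; subst)
  renaming (sym to ≡-sym; trans to ≡-trans)
open import Axiom.ExcludedMiddle using (ExcludedMiddle)
open import Axiom.DoubleNegationElimination
  using (DoubleNegationElimination; em⇒dne)
open import Algebra.Bundles using (AbelianGroup)
import Algebra.Definitions.RawMonoid as RawMonoidDefs
import Algebra.Properties.AbelianGroup as AbelianGroupProperties
import Algebra.Properties.CommutativeSemigroup as CommutativeSemigroupProperties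
import Algebra.Properties.Monoid.Mult as MonoidMult
import Relation.Binary.Reasoning.Setoid as SetoidReasoning

next : ℕ ∧ ℕ → ℕ ∧ ℕ
next (a , zero)  = (zero , suc a)
next (a , suc b) = (suc a , b)

decode : ℕ → ℕ ∧ ℕ
decode zero    = (zero , zero)
decode (suc i) = next (decode i)

walk : ∀ a b {i} → decode i ≡ (zero , a + b) → decode (a + i) ≡ (a , b)
walk zero    b eq = eq
walk (suc a) b eq = cong next (walk a (suc b) (≡-trans eq (cong (zero ,_) (≡-sym (+-suc a b)))))

-- Every diagonal is entered: its start follows the end of the previous one.
diagonal-start : ∀ s → ∃[ i ] (decode i ≡ (zero , s))
diagonal-start zero = zero , refl
diagonal-start (suc s) with diagonal-start s
... | i , eq = suc (s + i) , cong next (walk s zero start)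
  where
  start : decode i ≡ (zero , s + zero)
  start = ≡-trans eq (cong (zero ,_) (≡-sym (+-identityʳ s)))

decode-surjective : ∀ a b → ∃[ i ] (decode i ≡ (a , b))
decode-surjective a b with diagonal-start (a + b)
... | i , eq = a + i , walk a b eq

module Classical {a : Level} (em : ExcludedMiddle a) where

  χ : Set a → Bool
  χ A = does (em {A})

  χ-cong : {A B : Set a} → A ⇔ B → χ A ≡ χ B
  χ-cong A⇔B = does-⇔ A⇔B em em

  χ-transport : {A B : Set a} → χ A ≡ χ B → A → B
  χ-transport {B = B} eq x = holds em (≡-trans (≡-sym eq) (dec-true em x))
    where
    holds : (B? : Dec B) → does B? ≡ true → B
    holds (yes y) _ = y

stable-lower : ∀ {a b} → DoubleNegationElimination (a ⊔ b) → {A : Set a} → Stable A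
stable-lower {b = b} dne ¬¬x = lower (dne (λ ¬y → ¬¬x (λ x → ¬y (lift {ℓ = b} x))))

module Differences {c ℓ : Level} (G : AbelianGroup c ℓ) where
  open AbelianGroup G hiding (refl)
  open AbelianGroupProperties G using (ε⁻¹≈ε; ⁻¹-∙-comm; ⁻¹-anti-homo‿-)
  open CommutativeSemigroupProperties commutativeSemigroup using (interchange)
  open RawMonoidDefs rawMonoid using () renaming (_×_ to _·ℕ_)
  open SetoidReasoning setoid

  ×-distrib-difference : ∀ n g h → n ·ℕ (g ∙ h ⁻¹) ≈ (n ·ℕ g) ∙ (n ·ℕ h) ⁻¹
  ×-distrib-difference zero    g h = sym (trans (∙-congˡ ε⁻¹≈ε) (identityʳ ε))
  ×-distrib-difference (suc n) g h = begin
    (g ∙ h ⁻¹) ∙ (n ·ℕ (g ∙ h ⁻¹))        ≈⟨ ∙-congˡ (×-distrib-difference n g h) ⟩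
    (g ∙ h ⁻¹) ∙ ((n ·ℕ g) ∙ (n ·ℕ h) ⁻¹) ≈⟨ interchange _ _ _ _ ⟩
    (g ∙ (n ·ℕ g)) ∙ (h ⁻¹ ∙ (n ·ℕ h) ⁻¹)  ≈⟨ ∙-congˡ (⁻¹-∙-comm _ _) ⟩
    (g ∙ (n ·ℕ g)) ∙ (h ∙ (n ·ℕ h)) ⁻¹    ∎

  shift-difference : ∀ {y z a b t} → y ≈ a ∙ t → z ≈ b ∙ t → y ∙ z ⁻¹ ≈ a ∙ b ⁻¹
  shift-difference {y} {z} {a} {b} {t} y≈a+t z≈b+t = begin
    y ∙ z ⁻¹                ≈⟨ ∙-cong y≈a+t (⁻¹-cong z≈b+t) ⟩
    (a ∙ t) ∙ (b ∙ t) ⁻¹    ≈⟨ ∙-congˡ (sym (⁻¹-∙-comm b t)) ⟩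
    (a ∙ t) ∙ (b ⁻¹ ∙ t ⁻¹) ≈⟨ interchange _ _ _ _ ⟩
    (a ∙ b ⁻¹) ∙ (t ∙ t ⁻¹) ≈⟨ ∙-congˡ (inverseʳ t) ⟩
    (a ∙ b ⁻¹) ∙ ε          ≈⟨ identityʳ _ ⟩
    a ∙ b ⁻¹                ∎

  module _ {p : Level} (P : Pred Carrier p) where

    InTranslate : Carrier → Pred Carrier (c ⊔ ℓ ⊔ p)
    InTranslate t y = ∃[ a ] (P a ∧ y ≈ a ∙ t)

    InTranslate-cong : ∀ {t y z} → y ≈ z → InTranslate t y → InTranslate t z
    InTranslate-cong y≈z (a , a∈P , y≈a+t) = a , a∈P , trans (sym y≈z) y≈a+t

    DiffSet-⁻¹ : ∀ {y} → DiffSet G P y → DiffSet G P (y ⁻¹)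
    DiffSet-⁻¹ (a , b , a∈P , b∈P , y≈a-b) =
      b , a , b∈P , a∈P , trans (⁻¹-cong y≈a-b) (⁻¹-anti-homo‿- a b)

    ℤ-multiples : ∀ {x} → (∀ n → DiffSet G P (n ·ℕ x)) → ∀ k → DiffSet G P (_·ℤ_ G k x)
    ℤ-multiples xℕ⊆P-P (+ n)    = xℕ⊆P-P n
    ℤ-multiples xℕ⊆P-P -[1+ n ] = DiffSet-⁻¹ (xℕ⊆P-P (suc n))

    common-translate : ∀ n {g h t} → InTranslate t (n ·ℕ g) → InTranslate t (n ·ℕ h) →
      DiffSet G P (n ·ℕ (g ∙ h ⁻¹))
    common-translate n {g} {h} (a , a∈P , ng≈a+t) (b , b∈P , nh≈b+t) =
      a , b , a∈P , b∈P , trans (×-distrib-difference n g h) (shift-difference ng≈a+t nh≈b+t)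

module Colouring {c ℓ p : Level} (em : ExcludedMiddle (c ⊔ ℓ ⊔ p))
  (G : AbelianGroup c ℓ) (P : Pred (AbelianGroup.Carrier G) p)
  {m : ℕ} (s : Fin m → AbelianGroup.Carrier G) where
  open AbelianGroup G hiding (refl)
  open RawMonoidDefs rawMonoid using () renaming (_×_ to _·ℕ_)
  open MonoidMult monoid using (×-congʳ)
  open Differences G
  open Classical em

  LandsIn : ℕ → Pred Carrier (c ⊔ ℓ ⊔ p)
  LandsIn j y = ∃[ i ] (toℕ i ≡ j ∧ InTranslate P (s i) y)

  LandsIn-cong : ∀ {j y z} → y ≈ z → LandsIn j y → LandsIn j z
  LandsIn-cong y≈z (i , i≡j , y∈P+s) = i , i≡j , InTranslate-cong P y≈z y∈P+s

  bit : Carrier → ℕ ∧ ℕ → Bool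
  bit g (n , j) = χ (LandsIn j (n ·ℕ g))

  colour : Carrier → ℕ → Bool
  colour g = bit g ∘ decode

  colour-cong : ∀ {g h} → g ≈ h → ∀ idx → colour g idx ≡ colour h idx
  colour-cong g≈h idx with decode idx
  ... | n , j = χ-cong (mk⇔ (LandsIn-cong ng≈nh) (LandsIn-cong (sym ng≈nh)))
    where ng≈nh = ×-congʳ n g≈h

  same-colour⇒ℤ-multiples : (∀ g → ∃[ i ] InTranslate P (s i) g) →
    ∀ {g h} → (∀ idx → colour g idx ≡ colour h idx) →
    ∀ k → DiffSet G P (_·ℤ_ G k (g ∙ h ⁻¹))
  same-colour⇒ℤ-multiples covers {g} {h} same = ℤ-multiples P multiple
    where
    multiple : ∀ n → DiffSet G P (n ·ℕ (g ∙ h ⁻¹))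
    multiple n with covers (n ·ℕ g)
    ... | i , ng∈P+s with decode-surjective n (toℕ i)
    ... | idx , decoded with χ-transport (subst (λ q → bit g q ≡ bit h q) decoded (same idx))
                                         (i , refl , ng∈P+s)
    ... | i′ , i′≡i , nh∈P+s with toℕ-injective i′≡i
    ... | refl = common-translate P n ng∈P+s nh∈P+s

proposition5p4 : ∀ {c ℓ p : Level} → ExcludedMiddle (c ⊔ ℓ ⊔ p) →
    (G : AbelianGroup c ℓ) →
    ¬ Injection (AbelianGroup.setoid G) CantorSetoid →
    TorsionFree G →
    (P : Pred (AbelianGroup.Carrier G) p) →
    P Respects (AbelianGroup._≈_ G) →
    Generic G P →
    ∃[ x ] (¬ (AbelianGroup._≈_ G x (AbelianGroup.ε G)) ∧
    (∀ (k : ℤ) → DiffSet G P (_·ℤ_ G k x)))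
-- By double negation elimination: if no x ≠ 0 had xℤ ⊆ P − P, the colouring
-- would be injective, since g ≉ h makes x = g − h such a witness.
proposition5p4 {c} {ℓ} {p} em G noInjection _ P _ (_ , s , covers) =
  em⇒dne em λ noWitness → noInjection (record
    { to        = colour
    ; cong      = colour-cong
    ; injective = λ {g} {h} same → stable-lower {b = c ⊔ p} (em⇒dne em) λ g≉h →
        noWitness (g ∙ h ⁻¹ , g≉h ∘ x∙y⁻¹≈ε⇒x≈y g h , same-colour⇒ℤ-multiples covers same)
    })
  where
  open AbelianGroup G
  open AbelianGroupProperties G using (x∙y⁻¹≈ε⇒x≈y)
  open Colouring em G P s
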